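{- Let $G=G_1\boxtimes G_2$ be a strong product graph. Then for every vertex $v\in V(G)$ and every edge $(v,w)\in E(G)$: - the induced subgraph $\langle N_2[v]\rangle$ is a subproduct of $G$; - the graph $N^*_{v,w}$ is a subproduct of $G$; - if the edge $(v,w)$ is Cartesian, then the edge-neighborhood $\langle N[v]\cup N[w]\rangle$ is a subproduct of $G$.
   Context: All graphs are finite, simple, undirected. $N_k[v]=\{x: d(v,x)\le k\}$ and $N[v]=N_1[v]$; $\langle W\rangle$ is the induced subgraph on $W$. For an edge $(v,w)$, $N^*_{v,w}=\langle\bigcup_{x\in N[v]\cap N[w]}N[x]\rangle$. The strong product $G_1\boxtimes G_2$ has vertex set $V(G_1)\times V(G_2)$; distinct $(x_1,x_2),(y_1,y_2)$ are adjacent iff for each $i$, $x_i=y_i$ or $x_iy_i\in E(G_i)$. An edge is Cartesian if its endpoints differ in exactly one coordinate. A subproduct of $G_1\boxtimes G_2$ is a subgraph of the form $H_1\boxtimes H_2$ with $H_i$ a subgraph of $G_i$. -}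

module Defs where

open import Data.Nat using (ℕ; zero; suc)
open import Data.Fin using (Fin)
open import Data.Product using (Σ; Σ-syntax; _×_; _,_)
open import Data.Sum using (_⊎_)
open import Relation.Nullary using (¬_; Dec)
open import Relation.Binary.PropositionalEquality using (_≡_; _≢_)
open import Function.Bundles using (_⇔_)

record Graph : Set₁ where
  field
    n      : ℕ
    Adj    : Fin n → Fin n → Set
    adj?   : ∀ x y → Dec (Adj x y)
    sym    : ∀ {x y} → Adj x y → Adj y x
    irrefl : ∀ x → ¬ Adj x x
open Graph public

record Subgraph (G : Graph) : Set₁ where
  field
    VS     : Fin (n G) → Set
    ES     : Fin (n G) → Fin (n G) → Set
    ES⊆E   : ∀ {x y} → ES x y → Adj G x y
    ES-sym : ∀ {x y} → ES x y → ES y x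
    ES-VS  : ∀ {x y} → ES x y → VS x × VS y
open Subgraph public

module _ {V : Set} (R : V → V → Set) where

  -- Ball k v x  :⇔  d(v,x) ≤ k   (a walk of length ≤ k from v to x)
  Ball : ℕ → V → V → Set
  Ball zero    v x = v ≡ x
  Ball (suc k) v x = (v ≡ x) ⊎ (Σ[ z ∈ V ] (R v z × Ball k z x))

  Nb : V → V → Set
  Nb = Ball 1

  NStar : V → V → V → Set
  NStar v w x = Σ[ y ∈ V ] ((Nb v y × Nb w y) × Nb y x)

  EdgeNb : V → V → V → Set
  EdgeNb v w x = Nb v x ⊎ Nb w x

EqOrAdj : {V : Set} → (V → V → Set) → V → V → Set
EqOrAdj R a b = (a ≡ b) ⊎ R a b

SAdj : {V₁ V₂ : Set} → (V₁ → V₁ → Set) → (V₂ → V₂ → Set) → V₁ × V₂ → V₁ × V₂ → Set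
SAdj R₁ R₂ (x₁ , x₂) (y₁ , y₂) =
  ((x₁ , x₂) ≢ (y₁ , y₂)) × EqOrAdj R₁ x₁ y₁ × EqOrAdj R₂ x₂ y₂

PV : Graph → Graph → Set
PV G₁ G₂ = Fin (n G₁) × Fin (n G₂)

⊠Adj : (G₁ G₂ : Graph) → PV G₁ G₂ → PV G₁ G₂ → Set
⊠Adj G₁ G₂ = SAdj (Adj G₁) (Adj G₂)

Cartesian : {V₁ V₂ : Set} → V₁ × V₂ → V₁ × V₂ → Set
Cartesian (x₁ , x₂) (y₁ , y₂) = ((x₁ ≡ y₁) × (x₂ ≢ y₂)) ⊎ ((x₁ ≢ y₁) × (x₂ ≡ y₂))

SubprodV : {G₁ G₂ : Graph} → Subgraph G₁ → Subgraph G₂ → PV G₁ G₂ → Set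
SubprodV H₁ H₂ (x₁ , x₂) = VS H₁ x₁ × VS H₂ x₂

SubprodE : {G₁ G₂ : Graph} → Subgraph G₁ → Subgraph G₂ → PV G₁ G₂ → PV G₁ G₂ → Set
SubprodE H₁ H₂ x y = SubprodV H₁ H₂ x × SubprodV H₁ H₂ y × SAdj (ES H₁) (ES H₂) x y

InducedIsSubproduct : (G₁ G₂ : Graph) → (PV G₁ G₂ → Set) → Set₁
InducedIsSubproduct G₁ G₂ W =
  Σ[ H₁ ∈ Subgraph G₁ ] Σ[ H₂ ∈ Subgraph G₂ ]
    ((∀ x → W x ⇔ SubprodV H₁ H₂ x) ×
     (∀ x y → (W x × W y × ⊠Adj G₁ G₂ x y) ⇔ SubprodE H₁ H₂ x y))

-- In the strong product two vertices are within distance k iff they are so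
-- in each factor, and N[(v₁ , v₂)] = N[v₁] × N[v₂].  Every vertex set in the
-- corollary is built from closed neighbourhoods by intersections, images
-- under N, and unions of two boxes sharing a side (the last needs the edge
-- to be Cartesian), all of which preserve boxes A × B.  Finally the induced
-- subgraph on a box A × B is ⟨A⟩ ⊠ ⟨B⟩.
module Submission where

open import Level using (0ℓ)
open import Data.Nat using (zero; suc)
open import Data.Fin using (Fin)
open import Data.Fin.Properties using (_≟_)
open import Data.Product as Product using (Σ-syntax; _×_; _,_; proj₁; proj₂)
open import Data.Product.Properties using (≡-dec)
open import Data.Sum as Sum using (inj₁; inj₂)
open import Function using (_∘_)
open import Function.Bundles using (mk⇔)
open import Relation.Binary.Core using (Rel; _⇒_)
open import Relation.Binary.Definitions using (DecidableEquality)
open import Relation.Binary.PropositionalEquality using (refl)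
open import Relation.Nullary using (yes; no)
open import Relation.Unary using (Pred; _⊆_; _≐_; _∩_; _∪_; _⟨×⟩_)
open import Relation.Unary.Properties using (≐-sym; ≐-trans)

open import Defs

image : {V : Set} → Rel V 0ℓ → Pred V 0ℓ → Pred V 0ℓ
image {V} S P x = Σ[ y ∈ V ] (P y × S y x)

module _ {V : Set} (R : Rel V 0ℓ) where

  Ball-refl : ∀ k {v} → Ball R k v v
  Ball-refl zero    = refl
  Ball-refl (suc k) = inj₁ refl

  Ball-mono : ∀ k {v} → Ball R k v ⊆ Ball R (suc k) v
  Ball-mono zero    v≡x                = inj₁ v≡x
  Ball-mono (suc k) (inj₁ v≡x)         = inj₁ v≡x
  Ball-mono (suc k) (inj₂ (z , r , b)) = inj₂ (z , r , Ball-mono k b)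

  Ball-suc : ∀ k {v} → Ball R (suc k) v ≐ image (Ball R k) (Nb R v)
  Ball-suc k {v} = to , from
    where
    to : Ball R (suc k) v ⊆ image (Ball R k) (Nb R v)
    to (inj₁ refl)        = v , inj₁ refl , Ball-refl k
    to (inj₂ (z , r , b)) = z , inj₂ (z , r , refl) , b

    from : image (Ball R k) (Nb R v) ⊆ Ball R (suc k) v
    from (_ , inj₁ refl , b)           = Ball-mono k b
    from (_ , inj₂ (z , r , refl) , b) = inj₂ (z , r , b)

  EqOrAdj⇒Nb : EqOrAdj R ⇒ Nb R
  EqOrAdj⇒Nb (inj₁ a≡b) = inj₁ a≡b
  EqOrAdj⇒Nb (inj₂ r)   = inj₂ (_ , r , refl)

  Nb⇒EqOrAdj : Nb R ⇒ EqOrAdj R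
  Nb⇒EqOrAdj (inj₁ a≡b)            = inj₁ a≡b
  Nb⇒EqOrAdj (inj₂ (_ , r , refl)) = inj₂ r

module _ {V₁ V₂ : Set} where

  private variable
    W W′ : Pred (V₁ × V₂) 0ℓ
    A A′ : Pred V₁ 0ℓ
    B B′ : Pred V₂ 0ℓ

  ⟨×⟩-cong : A ≐ A′ → B ≐ B′ → (A ⟨×⟩ B) ≐ (A′ ⟨×⟩ B′)
  ⟨×⟩-cong (A⊆ , ⊆A) (B⊆ , ⊆B) = Product.map A⊆ B⊆ , Product.map ⊆A ⊆B

  ⟨×⟩-∩ : W ≐ (A ⟨×⟩ B) → W′ ≐ (A′ ⟨×⟩ B′) → (W ∩ W′) ≐ ((A ∩ A′) ⟨×⟩ (B ∩ B′))
  ⟨×⟩-∩ {W} {A} {B} {W′} {A′} {B′} (W⊆ , ⊆W) (W′⊆ , ⊆W′) = to , from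
    where
    to : (W ∩ W′) ⊆ ((A ∩ A′) ⟨×⟩ (B ∩ B′))
    to (w , w′) with W⊆ w | W′⊆ w′
    ... | a , b | a′ , b′ = (a , a′) , (b , b′)

    from : ((A ∩ A′) ⟨×⟩ (B ∩ B′)) ⊆ (W ∩ W′)
    from ((a , a′) , (b , b′)) = ⊆W (a , b) , ⊆W′ (a′ , b′)

  ⟨×⟩-∪ˡ : W ≐ (A ⟨×⟩ B) → W′ ≐ (A′ ⟨×⟩ B) → (W ∪ W′) ≐ ((A ∪ A′) ⟨×⟩ B)
  ⟨×⟩-∪ˡ {W} {A} {B} {W′} {A′} (W⊆ , ⊆W) (W′⊆ , ⊆W′) = to , from
    where
    to : (W ∪ W′) ⊆ ((A ∪ A′) ⟨×⟩ B)
    to (inj₁ w)  = Product.map₁ inj₁ (W⊆ w)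
    to (inj₂ w′) = Product.map₁ inj₂ (W′⊆ w′)

    from : ((A ∪ A′) ⟨×⟩ B) ⊆ (W ∪ W′)
    from (inj₁ a  , b) = inj₁ (⊆W (a , b))
    from (inj₂ a′ , b) = inj₂ (⊆W′ (a′ , b))

  ⟨×⟩-∪ʳ : W ≐ (A ⟨×⟩ B) → W′ ≐ (A ⟨×⟩ B′) → (W ∪ W′) ≐ (A ⟨×⟩ (B ∪ B′))
  ⟨×⟩-∪ʳ {W} {A} {B} {W′} {B′} (W⊆ , ⊆W) (W′⊆ , ⊆W′) = to , from
    where
    to : (W ∪ W′) ⊆ (A ⟨×⟩ (B ∪ B′))
    to (inj₁ w)  = Product.map₂ inj₁ (W⊆ w)
    to (inj₂ w′) = Product.map₂ inj₂ (W′⊆ w′)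

    from : (A ⟨×⟩ (B ∪ B′)) ⊆ (W ∪ W′)
    from (a , inj₁ b)  = inj₁ (⊆W (a , b))
    from (a , inj₂ b′) = inj₂ (⊆W′ (a , b′))

  image-⟨×⟩ : {S : Rel (V₁ × V₂) 0ℓ} {S₁ : Rel V₁ 0ℓ} {S₂ : Rel V₂ 0ℓ} →
              (∀ {y₁ y₂} → S (y₁ , y₂) ≐ (S₁ y₁ ⟨×⟩ S₂ y₂)) → W ≐ (A ⟨×⟩ B) →
              image S W ≐ (image S₁ A ⟨×⟩ image S₂ B)
  image-⟨×⟩ {W} {A} {B} {S} {S₁} {S₂} S≐ (W⊆ , ⊆W) = to , from
    where
    to : image S W ⊆ (image S₁ A ⟨×⟩ image S₂ B)
    to ((y₁ , y₂) , w , s) with W⊆ w | proj₁ S≐ s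
    ... | a , b | s₁ , s₂ = (y₁ , a , s₁) , (y₂ , b , s₂)

    from : (image S₁ A ⟨×⟩ image S₂ B) ⊆ image S W
    from ((y₁ , a , s₁) , (y₂ , b , s₂)) = (y₁ , y₂) , ⊆W (a , b) , proj₂ S≐ (s₁ , s₂)

module StrongProduct {V₁ V₂ : Set} {R₁ : Rel V₁ 0ℓ} {R₂ : Rel V₂ 0ℓ}
                     (_≟₁_ : DecidableEquality V₁) (_≟₂_ : DecidableEquality V₂) where

  private
    R : Rel (V₁ × V₂) 0ℓ
    R = SAdj R₁ R₂

  Nb-SAdj : ∀ {v₁ v₂} → Nb R (v₁ , v₂) ≐ (Nb R₁ v₁ ⟨×⟩ Nb R₂ v₂)
  Nb-SAdj {v₁} {v₂} = to , from
    where
    to : Nb R (v₁ , v₂) ⊆ (Nb R₁ v₁ ⟨×⟩ Nb R₂ v₂)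
    to (inj₁ refl)                       = inj₁ refl , inj₁ refl
    to (inj₂ (_ , (_ , e₁ , e₂) , refl)) = EqOrAdj⇒Nb R₁ e₁ , EqOrAdj⇒Nb R₂ e₂

    from : (Nb R₁ v₁ ⟨×⟩ Nb R₂ v₂) ⊆ Nb R (v₁ , v₂)
    from {x} (n₁ , n₂) with ≡-dec _≟₁_ _≟₂_ (v₁ , v₂) x
    ... | yes v≡x = inj₁ v≡x
    ... | no  v≢x = inj₂ (x , (v≢x , Nb⇒EqOrAdj R₁ n₁ , Nb⇒EqOrAdj R₂ n₂) , refl)

  Ball-SAdj : ∀ k {v₁ v₂} → Ball R k (v₁ , v₂) ≐ (Ball R₁ k v₁ ⟨×⟩ Ball R₂ k v₂)
  Ball-SAdj zero = (λ { refl → refl , refl }) , (λ { (refl , refl) → refl })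
  Ball-SAdj (suc k) =
    ≐-trans (Ball-suc R k)
   (≐-trans (image-⟨×⟩ (Ball-SAdj k) Nb-SAdj)
            (⟨×⟩-cong (≐-sym (Ball-suc R₁ k)) (≐-sym (Ball-suc R₂ k))))

  NStar-SAdj : ∀ {v₁ v₂ w₁ w₂} →
               NStar R (v₁ , v₂) (w₁ , w₂) ≐ (NStar R₁ v₁ w₁ ⟨×⟩ NStar R₂ v₂ w₂)
  NStar-SAdj = image-⟨×⟩ Nb-SAdj (⟨×⟩-∩ Nb-SAdj Nb-SAdj)

  EdgeNb-SAdj-horizontal : ∀ {v₁ w₁ v₂} →
    EdgeNb R (v₁ , v₂) (w₁ , v₂) ≐ ((Nb R₁ v₁ ∪ Nb R₁ w₁) ⟨×⟩ Nb R₂ v₂)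
  EdgeNb-SAdj-horizontal = ⟨×⟩-∪ˡ Nb-SAdj Nb-SAdj

  EdgeNb-SAdj-vertical : ∀ {v₁ v₂ w₂} →
    EdgeNb R (v₁ , v₂) (v₁ , w₂) ≐ (Nb R₁ v₁ ⟨×⟩ (Nb R₂ v₂ ∪ Nb R₂ w₂))
  EdgeNb-SAdj-vertical = ⟨×⟩-∪ʳ Nb-SAdj Nb-SAdj

inducedSubgraph : (G : Graph) → Pred (Fin (n G)) 0ℓ → Subgraph G
inducedSubgraph G A = record
  { VS     = A
  ; ES     = λ x y → A x × A y × Adj G x y
  ; ES⊆E   = proj₂ ∘ proj₂
  ; ES-sym = λ (a , b , e) → b , a , sym G e
  ; ES-VS  = λ (a , b , _) → a , b
  }

⟨×⟩⇒InducedIsSubproduct : {G₁ G₂ : Graph} {W : Pred (PV G₁ G₂) 0ℓ}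
                            {A : Pred (Fin (n G₁)) 0ℓ} {B : Pred (Fin (n G₂)) 0ℓ} →
                            W ≐ (A ⟨×⟩ B) → InducedIsSubproduct G₁ G₂ W
⟨×⟩⇒InducedIsSubproduct {G₁} {G₂} {W} {A} {B} (W⊆ , ⊆W) =
  H₁ , H₂ , (λ _ → mk⇔ W⊆ ⊆W) , (λ _ _ → mk⇔ to from)
  where
  H₁ : Subgraph G₁
  H₁ = inducedSubgraph G₁ A

  H₂ : Subgraph G₂
  H₂ = inducedSubgraph G₂ B

  to : ∀ {x y} → W x × W y × ⊠Adj G₁ G₂ x y → SubprodE H₁ H₂ x y
  to (wx , wy , x≢y , e₁ , e₂) with W⊆ wx | W⊆ wy
  ... | a , b | a′ , b′ =
    (a , b) , (a′ , b′) , x≢y , Sum.map₂ (λ r → a , a′ , r) e₁ , Sum.map₂ (λ r → b , b′ , r) e₂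

  from : ∀ {x y} → SubprodE H₁ H₂ x y → W x × W y × ⊠Adj G₁ G₂ x y
  from (ab , a′b′ , x≢y , e₁ , e₂) =
    ⊆W ab , ⊆W a′b′ , x≢y , Sum.map₂ (ES⊆E H₁) e₁ , Sum.map₂ (ES⊆E H₂) e₂

corollary3p6 : (G₁ G₂ : Graph) →
    ((v : PV G₁ G₂) → InducedIsSubproduct G₁ G₂ (Ball (⊠Adj G₁ G₂) 2 v)) ×
    ((v w : PV G₁ G₂) → ⊠Adj G₁ G₂ v w →
       InducedIsSubproduct G₁ G₂ (NStar (⊠Adj G₁ G₂) v w)) ×
    ((v w : PV G₁ G₂) → ⊠Adj G₁ G₂ v w → Cartesian v w →
       InducedIsSubproduct G₁ G₂ (EdgeNb (⊠Adj G₁ G₂) v w))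
corollary3p6 G₁ G₂ =
    (λ _ → ⟨×⟩⇒InducedIsSubproduct (Ball-SAdj 2))
  , (λ _ _ _ → ⟨×⟩⇒InducedIsSubproduct NStar-SAdj)
  , λ { _ _ _ (inj₁ (refl , _)) → ⟨×⟩⇒InducedIsSubproduct EdgeNb-SAdj-vertical
      ; _ _ _ (inj₂ (_ , refl)) → ⟨×⟩⇒InducedIsSubproduct EdgeNb-SAdj-horizontal }
  where open StrongProduct {R₁ = Adj G₁} {R₂ = Adj G₂} _≟_ _≟_
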